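{- Let $G$ be a graph with a bridge $e$ (an edge whose deletion disconnects $G$), and let $G_1$ and $G_2$ be the two connected components of $G-e$. Then $\mathrm{scw}(G)=\max\{\mathrm{scw}(G_1),\mathrm{scw}(G_2)\}$.
   Context: All graphs are finite connected multigraphs (multiple edges allowed, no loops). Screewidth: a tree-cut decomposition of a graph $G$ is a pair $(T,\mathcal{X})$ with $T$ a tree (vertices = nodes, edges = links) and $\mathcal{X}=\{X_b: b\in V(T)\}$ pairwise disjoint, possibly empty subsets of $V(G)$ (bags) with union $V(G)$. For a link $l$, $\mathrm{adh}(l)$ is the set of edges of $G$ with endpoints in bags $X_b,X_d$ where $b,d$ lie in different components of $T-l$; for a node $b$, $\mathrm{adh}(b)$ is the set of edges of $G$ with endpoints in bags $X_c,X_d$ where $c,d$ lie in different components of $T-b$. The width is $\max\{\max_l|\mathrm{adh}(l)|,\ \max_b(|X_b|+|\mathrm{adh}(b)|)\}$, and $\mathrm{scw}(G)$ is the minimum width over all tree-cut decompositions of $G$. -}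

module Defs where

open import Data.Nat using (ℕ; _+_; _≤_; _<_)
open import Data.Fin using (Fin)
open import Data.Fin.Subset using (Subset; _∈_; ∣_∣)
open import Data.Product using (Σ; _×_; _,_; proj₁; proj₂)
open import Data.Sum using (_⊎_; inj₁; inj₂)
open import Data.Unit using (⊤; tt)
open import Relation.Nullary using (¬_)
open import Relation.Binary.PropositionalEquality using (_≡_; _≢_)
open import Function.Bundles using (_⤖_; Bijection)

-- Finite multigraphs: vertices Fin nV, edges Fin nE, each edge has an
-- (unordered, but stored as a pair) set of two endpoints.

record Multigraph : Set where
  field
    nV   : ℕ
    nE   : ℕ
    ends : Fin nE → Fin nV × Fin nV
open Multigraph public

Joins : {n : ℕ} → Fin n × Fin n → Fin n → Fin n → Set
Joins (a , b) u v = (a ≡ u × b ≡ v) ⊎ (b ≡ u × a ≡ v)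

-- Walks in H using only edges satisfying `ok` (so `ok` encodes deleting edges).
data Walk (H : Multigraph) (ok : Fin (nE H) → Set) : Fin (nV H) → Fin (nV H) → Set where
  stay : ∀ {u} → Walk H ok u u
  step : ∀ {u v w} (i : Fin (nE H)) → ok i → Joins (ends H i) u v →
         Walk H ok v w → Walk H ok u w

AllEdges : {k : ℕ} → Fin k → Set
AllEdges _ = ⊤

Connected : Multigraph → Set
Connected H = ∀ u v → Walk H AllEdges u v

Loopless : Multigraph → Set
Loopless H = ∀ i → proj₁ (ends H i) ≢ proj₂ (ends H i)

record Graph : Set where
  field
    mg        : Multigraph
    loopless  : Loopless mg
    connected : Connected mg
open Graph public

NotLink : {k : ℕ} → Fin k → Fin k → Set
NotLink l i = i ≢ l

NotIncident : (H : Multigraph) → Fin (nV H) → Fin (nE H) → Set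
NotIncident H b i = proj₁ (ends H i) ≢ b × proj₂ (ends H i) ≢ b

-- Tree: nonempty, connected, acyclic (no link lies on a cycle, i.e. for
-- every link its endpoints are disconnected in T minus that link; this
-- also excludes loops and parallel links).
record IsTree (T : Multigraph) : Set where
  field
    nonempty  : 0 < nV T
    connected : Connected T
    acyclic   : ∀ l → ¬ Walk T (NotLink l) (proj₁ (ends T l)) (proj₂ (ends T l))

-- Tree-cut decompositions. The pairwise disjoint bags with union V(G)
-- are encoded by the map `bag` sending each vertex to the node whose
-- bag contains it: X_b = { v | bag v ≡ b }.

record TCD (G : Graph) : Set where
  field
    T      : Multigraph
    isTree : IsTree T
    bag    : Fin (nV (mg G)) → Fin (nV T)
open TCD public

module _ {G : Graph} (D : TCD G) where
  private
    H = mg G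
    TT = T D

  InBag : Fin (nV TT) → Fin (nV H) → Set
  InBag b v = bag D v ≡ b

  AdhLink : Fin (nE TT) → Fin (nE H) → Set
  AdhLink l e = ¬ Walk TT (NotLink l) (bag D (proj₁ (ends H e))) (bag D (proj₂ (ends H e)))

  AdhNode : Fin (nV TT) → Fin (nE H) → Set
  AdhNode b e = bag D (proj₁ (ends H e)) ≢ b × bag D (proj₂ (ends H e)) ≢ b ×
                ¬ Walk TT (NotIncident TT b) (bag D (proj₁ (ends H e))) (bag D (proj₂ (ends H e)))

-- S covers every element satisfying P; so "∃ S covering P with ∣ S ∣ ≤ w"
-- is exactly "|{i | P i}| ≤ w".
Covers : {k : ℕ} → (Fin k → Set) → Subset k → Set
Covers P S = ∀ i → P i → i ∈ S

WidthAtMost : {G : Graph} → TCD G → ℕ → Set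
WidthAtMost {G} D w =
  (∀ l → Σ (Subset (nE (mg G))) λ S → Covers (AdhLink D l) S × ∣ S ∣ ≤ w) ×
  (∀ b → Σ (Subset (nV (mg G))) λ S₁ → Σ (Subset (nE (mg G))) λ S₂ →
           Covers (InBag D b) S₁ × Covers (AdhNode D b) S₂ × ∣ S₁ ∣ + ∣ S₂ ∣ ≤ w)

IsScw : Graph → ℕ → Set
IsScw G k = (Σ (TCD G) λ D → WidthAtMost D k) ×
            (∀ (D : TCD G) w → WidthAtMost D w → k ≤ w)

-- Encoded (up to isomorphism) by: a bijection of vertices
-- V(G₁) ⊎ V(G₂) ⤖ V(G), and a bijection of edges
-- {e} ⊎ E(G₁) ⊎ E(G₂) ⤖ E(G) compatible with endpoints, where e joins
-- a vertex of G₁ to a vertex of G₂. Since G₁, G₂ are connected graphs,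
-- this says exactly that G - e has components G₁, G₂ (so e is a bridge).

SameEnds : {n : ℕ} → Fin n × Fin n → Fin n × Fin n → Set
SameEnds (a , b) (c , d) = (a ≡ c × b ≡ d) ⊎ (a ≡ d × b ≡ c)

mapPair : {A B : Set} → (A → B) → A × A → B × B
mapPair f (a , b) = (f a , f b)

record BridgeSplit (G G₁ G₂ : Graph) : Set where
  field
    vtx : (Fin (nV (mg G₁)) ⊎ Fin (nV (mg G₂))) ⤖ Fin (nV (mg G))
    edg : (⊤ ⊎ (Fin (nE (mg G₁)) ⊎ Fin (nE (mg G₂)))) ⤖ Fin (nE (mg G))
  private
    v : _ → Fin (nV (mg G))
    v = Bijection.to vtx
    ed : _ → Fin (nE (mg G))
    ed = Bijection.to edg
  field
    edges₁ : ∀ j → SameEnds (ends (mg G) (ed (inj₂ (inj₁ j))))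
                            (mapPair (λ x → v (inj₁ x)) (ends (mg G₁) j))
    edges₂ : ∀ j → SameEnds (ends (mg G) (ed (inj₂ (inj₂ j))))
                            (mapPair (λ x → v (inj₂ x)) (ends (mg G₂) j))
    bridgeEnd₁ : Fin (nV (mg G₁))
    bridgeEnd₂ : Fin (nV (mg G₂))
    bridge : SameEnds (ends (mg G) (ed (inj₁ tt))) (v (inj₁ bridgeEnd₁) , v (inj₂ bridgeEnd₂))

-- A tree-cut decomposition of G restricts to one of each component Gᵢ (keep the tree, pull back the
-- bags); adhesions only shrink, so scw(Gᵢ) ≤ scw(G).  Conversely, optimal decompositions of G₁ and G₂
-- are glued into one of G by a new link between the nodes whose bags contain the ends of the bridge.
-- Every edge of G₁ or G₂ stays in the adhesions it had before, and the bridge lies only in the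
-- adhesion of the new link, which therefore has size 1 ≤ scw(G₁).
module Submission where

open import Defs
open import Data.Nat using (ℕ; _⊔_; suc; _+_; _≤_; z≤n; s≤s)
open import Data.Nat.Properties using (≤-trans; ≤-reflexive; +-mono-≤; m≤m+n; m≤m⊔n; m≤n⊔m; ⊔-lub; <-≤-trans)
open import Data.Fin using (Fin; zero; suc; _↑ˡ_; _↑ʳ_; splitAt)
open import Data.Fin.Properties
  using (0≢1+n; suc-injective; splitAt-↑ˡ; splitAt-↑ʳ; ↑ˡ-injective; ↑ʳ-injective; join-splitAt)
open import Data.Fin.Subset using (Subset; _∈_; ∣_∣; inside; outside; ⁅_⁆; _-_)
open import Data.Fin.Subset.Properties using (x∈⁅x⁆; ∣⁅x⁆∣≡1; x∈p∧x≢y⇒x∈p-y; x∈p⇒∣p-x∣<∣p∣)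
open import Data.Vec using ([]; _∷_; lookup; tabulate; here; there)
open import Data.Vec.Properties using ([]=⇒lookup; lookup⇒[]=; lookup∘tabulate)
open import Data.Maybe using (Maybe; just; nothing; maybe′)
open import Data.Maybe.Properties using (just-injective)
open import Data.Product using (Σ; ∃; _×_; _,_; proj₁; proj₂; uncurry)
open import Data.Sum using (_⊎_; inj₁; inj₂; [_,_]′)
open import Data.Sum.Properties using (inj₁-injective; inj₂-injective)
open import Data.Bool using (Bool; true; false)
open import Data.Unit using (⊤; tt)
open import Data.Empty using (⊥-elim)
open import Relation.Nullary using (¬_)
open import Relation.Binary.Definitions using (Symmetric)
open import Relation.Binary.PropositionalEquality
open import Function using (_∘_; id; const)
open import Function.Bundles using (Bijection; Inverse; Injection; _↔_)
open import Function.Definitions using (Injective)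
open import Function.Properties.Bijection using (⤖⇒↔)
open import Function.Properties.Inverse using (↔-sym; ↔⇒↣)

private
  variable
    n m : ℕ

SameEnds-sym : {p q : Fin n × Fin n} → SameEnds p q → SameEnds q p
SameEnds-sym (inj₁ (a , b)) = inj₁ (sym a , sym b)
SameEnds-sym (inj₂ (a , b)) = inj₂ (sym b , sym a)

SameEnds-map : (f : Fin n → Fin m) {p q : Fin n × Fin n} →
               SameEnds p q → SameEnds (mapPair f p) (mapPair f q)
SameEnds-map f (inj₁ (a , b)) = inj₁ (cong f a , cong f b)
SameEnds-map f (inj₂ (a , b)) = inj₂ (cong f a , cong f b)

≡⇒SameEnds : {p q : Fin n × Fin n} → p ≡ q → SameEnds p q
≡⇒SameEnds refl = inj₁ (refl , refl)

SameEnds-≡ : {p : Fin n × Fin n} {x y x′ y′ : Fin n} →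
             SameEnds p (x , y) → x ≡ x′ → y ≡ y′ → SameEnds p (x′ , y′)
SameEnds-≡ s refl refl = s

SameEnds-transport : (W : Fin n → Fin n → Set) → Symmetric W →
                     {p q : Fin n × Fin n} → SameEnds p q → uncurry W q → uncurry W p
SameEnds-transport W W-sym (inj₁ (refl , refl)) w = w
SameEnds-transport W W-sym (inj₂ (refl , refl)) w = W-sym w

SameEnds-Joins : {p q : Fin n × Fin n} {u v : Fin n} → SameEnds p q → Joins q u v → Joins p u v
SameEnds-Joins (inj₁ (a , b)) (inj₁ (c , d)) = inj₁ (trans a c , trans b d)
SameEnds-Joins (inj₁ (a , b)) (inj₂ (c , d)) = inj₂ (trans b c , trans a d)
SameEnds-Joins (inj₂ (a , b)) (inj₁ (c , d)) = inj₂ (trans b c , trans a d)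
SameEnds-Joins (inj₂ (a , b)) (inj₂ (c , d)) = inj₁ (trans a c , trans b d)

Joins-map : (f : Fin n → Fin m) {e : Fin n × Fin n} {u v : Fin n} →
            Joins e u v → Joins (mapPair f e) (f u) (f v)
Joins-map f (inj₁ (refl , refl)) = inj₁ (refl , refl)
Joins-map f (inj₂ (refl , refl)) = inj₂ (refl , refl)

Joins-retract : (f : Fin n → Fin m) (r : Fin m → Fin n) → (∀ x → r (f x) ≡ x) →
                {e : Fin n × Fin n} {u v : Fin m} → Joins (mapPair f e) u v → Joins e (r u) (r v)
Joins-retract f r rf (inj₁ (refl , refl)) = inj₁ (sym (rf _) , sym (rf _))
Joins-retract f r rf (inj₂ (refl , refl)) = inj₂ (sym (rf _) , sym (rf _))

Joins-sym : {e : Fin n × Fin n} {u v : Fin n} → Joins e u v → Joins e v u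
Joins-sym (inj₁ (p , q)) = inj₂ (q , p)
Joins-sym (inj₂ (p , q)) = inj₁ (q , p)

Joins-≡ : {A : Set} (f : Fin n → A) {e : Fin n × Fin n} →
          f (proj₁ e) ≡ f (proj₂ e) → ∀ {u v} → Joins e u v → f u ≡ f v
Joins-≡ f eq (inj₁ (refl , refl)) = eq
Joins-≡ f eq (inj₂ (refl , refl)) = sym eq

module _ {H : Multigraph} {ok : Fin (nE H) → Set} where

  infixr 5 _++ʷ_
  _++ʷ_ : ∀ {u v w} → Walk H ok u v → Walk H ok v w → Walk H ok u w
  stay         ++ʷ q = q
  step i o j p ++ʷ q = step i o j (p ++ʷ q)

  reverseʷ : ∀ {u v} → Walk H ok u v → Walk H ok v u
  reverseʷ stay           = stay
  reverseʷ (step i o j p) = reverseʷ p ++ʷ step i o (Joins-sym j) stay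

  stay-≡ : ∀ {u v} → u ≡ v → Walk H ok u v
  stay-≡ refl = stay

  invariantʷ : {A : Set} (f : Fin (nV H) → A) →
               (∀ i → ok i → f (proj₁ (ends H i)) ≡ f (proj₂ (ends H i))) →
               ∀ {u v} → Walk H ok u v → f u ≡ f v
  invariantʷ f inv stay           = refl
  invariantʷ f inv (step i o j p) = trans (Joins-≡ f (inv i o) j) (invariantʷ f inv p)

mapʷ : {H K : Multigraph} {ok : Fin (nE H) → Set} {ok′ : Fin (nE K) → Set}
       (r : Fin (nV H) → Fin (nV K)) →
       (∀ {u v} i → ok i → Joins (ends H i) u v → Walk K ok′ (r u) (r v)) →
       ∀ {u v} → Walk H ok u v → Walk K ok′ (r u) (r v)
mapʷ r f stay           = stay
mapʷ r f (step i o j p) = f i o j ++ʷ mapʷ r f p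

Disconnected : (H : Multigraph) → (Fin (nE H) → Set) → Fin (nV H) → Fin (nV H) → Set
Disconnected H ok u v = ¬ Walk H ok u v

Disconnected-sym : ∀ {H ok} → Symmetric (Disconnected H ok)
Disconnected-sym ¬w = ¬w ∘ reverseʷ

SeparatedBy : (H : Multigraph) → Fin (nV H) → Fin (nV H) → Fin (nV H) → Set
SeparatedBy H b u v = u ≢ b × v ≢ b × Disconnected H (NotIncident H b) u v

SeparatedBy-sym : ∀ {H b} → Symmetric (SeparatedBy H b)
SeparatedBy-sym (u≢b , v≢b , ¬w) = v≢b , u≢b , Disconnected-sym ¬w

record Hom (H K : Multigraph) : Set where
  field
    vmap      : Fin (nV H) → Fin (nV K)
    emap      : Fin (nE H) → Fin (nE K)
    ends-emap : ∀ i → SameEnds (ends K (emap i)) (mapPair vmap (ends H i))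

  liftʷ : ∀ {ok ok′} → (∀ i → ok i → ok′ (emap i)) →
          ∀ {u v} → Walk H ok u v → Walk K ok′ (vmap u) (vmap v)
  liftʷ ok⇒ok′ = mapʷ vmap λ i o j → step (emap i) (ok⇒ok′ i o) (SameEnds-Joins (ends-emap i) (Joins-map vmap j)) stay

  NotIncident-emap : ∀ {b} i → vmap (proj₁ (ends H i)) ≢ b → vmap (proj₂ (ends H i)) ≢ b →
                     NotIncident K b (emap i)
  NotIncident-emap i x≢b y≢b with ends-emap i
  ... | inj₁ (a , c) = x≢b ∘ trans (sym a) , y≢b ∘ trans (sym c)
  ... | inj₂ (a , c) = y≢b ∘ trans (sym a) , x≢b ∘ trans (sym c)

  -- A walk avoiding emap l retracts onto one avoiding l, so a link in the image of a tree lies on no cycle.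
  module Retraction (r : Fin (nV K) → Fin (nV H)) (r-vmap : ∀ x → r (vmap x) ≡ x)
                    (image-or-collapsed : ∀ i → (∃ λ j → emap j ≡ i) ⊎ r (proj₁ (ends K i)) ≡ r (proj₂ (ends K i)))
                    where

    retractʷ : ∀ l {u v} → Walk K (NotLink (emap l)) u v → Walk H (NotLink l) (r u) (r v)
    retractʷ l = mapʷ r onLink
      where
      onLink : ∀ {u v} i → NotLink (emap l) i → Joins (ends K i) u v → Walk H (NotLink l) (r u) (r v)
      onLink i i≢l j with image-or-collapsed i
      ... | inj₁ (j′ , refl) = step j′ (i≢l ∘ cong emap)
                                 (Joins-retract vmap r r-vmap (SameEnds-Joins (SameEnds-sym (ends-emap j′)) j)) stay
      ... | inj₂ eq          = stay-≡ (Joins-≡ r eq j)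

    acyclic-emap : IsTree H → ∀ l → Disconnected K (NotLink (emap l)) (proj₁ (ends K (emap l))) (proj₂ (ends K (emap l)))
    acyclic-emap tree l w = IsTree.acyclic tree l
      (subst₂ (Walk H (NotLink l)) (r-vmap _) (r-vmap _)
        (retractʷ l (SameEnds-transport (Walk K (NotLink (emap l))) reverseʷ (SameEnds-sym (ends-emap l)) w)))

∣p∣≤∣q∣-injection : (p : Subset m) (q : Subset n) (f : ∀ {x} → x ∈ p → Fin n) →
                    (∀ {x y} (x∈p : x ∈ p) (y∈p : y ∈ p) → f x∈p ≡ f y∈p → x ≡ y) →
                    (∀ {x} (x∈p : x ∈ p) → f x∈p ∈ q) → ∣ p ∣ ≤ ∣ q ∣
∣p∣≤∣q∣-injection []            q f f-inj f∈q = z≤n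
∣p∣≤∣q∣-injection (outside ∷ p) q f f-inj f∈q =
  ∣p∣≤∣q∣-injection p q (f ∘ there) (λ x∈p y∈p → suc-injective ∘ f-inj (there x∈p) (there y∈p)) (f∈q ∘ there)
∣p∣≤∣q∣-injection (inside ∷ p)  q f f-inj f∈q =
  ≤-trans (s≤s (∣p∣≤∣q∣-injection p (q - f here) (f ∘ there)
                  (λ x∈p y∈p → suc-injective ∘ f-inj (there x∈p) (there y∈p))
                  (λ x∈p → x∈p∧x≢y⇒x∈p-y (f∈q (there x∈p)) (0≢1+n ∘ sym ∘ f-inj (there x∈p) here))))
          (x∈p⇒∣p-x∣<∣p∣ (f∈q here))

PartialInjective : {A B : Set} → (A → Maybe B) → Set
PartialInjective h = ∀ {x y j} → h x ≡ just j → h y ≡ just j → x ≡ y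

PartialInjective-∘ : {A B C : Set} {h : B → Maybe C} {g : A → B} →
                     PartialInjective h → Injective _≡_ _≡_ g → PartialInjective (h ∘ g)
PartialInjective-∘ h-inj g-inj hx hy = g-inj (h-inj hx hy)

just-partialInjective : {A : Set} → PartialInjective {A} just
just-partialInjective hx hy = just-injective (trans hx (sym hy))

PartialInjective-[,nothing] : {A B C : Set} {h : A → Maybe C} →
                              PartialInjective h → PartialInjective {A ⊎ B} [ h , const nothing ]′
PartialInjective-[,nothing] h-inj {inj₁ x} {inj₁ y} hx hy = cong inj₁ (h-inj hx hy)

PartialInjective-[nothing,] : {A B C : Set} {h : B → Maybe C} →
                              PartialInjective h → PartialInjective {A ⊎ B} [ const nothing , h ]′
PartialInjective-[nothing,] h-inj {inj₂ x} {inj₂ y} hx hy = cong inj₂ (h-inj hx hy)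

pullback : (Fin n → Maybe (Fin m)) → Subset m → Subset n
pullback h S = tabulate (maybe′ (lookup S) outside ∘ h)

module _ {h : Fin n → Maybe (Fin m)} where

  ∈-pullback⁺ : ∀ {S i j} → h i ≡ just j → j ∈ S → i ∈ pullback h S
  ∈-pullback⁺ {S} {i} hi≡j j∈S =
    lookup⇒[]= i _ (trans (lookup∘tabulate _ i) (trans (cong (maybe′ (lookup S) outside) hi≡j) ([]=⇒lookup j∈S)))

  ∈-pullback⁻ : ∀ S {i} → i ∈ pullback h S → ∃ λ j → h i ≡ just j × j ∈ S
  ∈-pullback⁻ S {i} i∈ with h i | trans (sym (lookup∘tabulate _ i)) ([]=⇒lookup i∈)
  ... | just j | Sj = j , refl , lookup⇒[]= j S Sj

  ∣pullback∣≤ : PartialInjective h → ∀ S → ∣ pullback h S ∣ ≤ ∣ S ∣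
  ∣pullback∣≤ h-inj S = ∣p∣≤∣q∣-injection (pullback h S) S (proj₁ ∘ ∈-pullback⁻ S)
    (λ x∈ y∈ eq → h-inj (proj₁ (proj₂ (∈-pullback⁻ S x∈))) (trans (proj₁ (proj₂ (∈-pullback⁻ S y∈))) (cong just (sym eq))))
    (proj₂ ∘ proj₂ ∘ ∈-pullback⁻ S)

-- Restricting a decomposition to a subgraph

-- AdhLink D l e and AdhNode D b e unfold to Disconnected (T D) (NotLink l) and SeparatedBy (T D) b
-- applied to bagEnds D e.
bagEnds : {G : Graph} (D : TCD G) → Fin (nE (mg G)) → Fin (nV (T D)) × Fin (nV (T D))
bagEnds {G} D e = mapPair (bag D) (ends (mg G) e)

record Embedding (H K : Graph) : Set where
  field
    hom : Hom (mg H) (mg K)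
  open Hom hom public
  field
    vmap-injective : Injective _≡_ _≡_ vmap
    emap-injective : Injective _≡_ _≡_ emap

module _ {H K : Graph} (φ : Embedding H K) where
  open Embedding φ

  restrict : TCD K → TCD H
  restrict D = record { T = T D ; isTree = isTree D ; bag = bag D ∘ vmap }

  restrict-width : (D : TCD K) {w : ℕ} → WidthAtMost D w → WidthAtMost (restrict D) w
  restrict-width D {w} (links , nodes) = restricted-links , restricted-nodes
    where
    adhesion-emap : ∀ W → Symmetric W → ∀ j → uncurry W (bagEnds (restrict D) j) → uncurry W (bagEnds D (emap j))
    adhesion-emap W W-sym j = SameEnds-transport W W-sym (SameEnds-map (bag D) (ends-emap j))

    pullback-emap : Subset (nE (mg K)) → Subset (nE (mg H))
    pullback-emap = pullback (just ∘ emap)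

    ∣pullback-emap∣≤ : ∀ S → ∣ pullback-emap S ∣ ≤ ∣ S ∣
    ∣pullback-emap∣≤ = ∣pullback∣≤ (PartialInjective-∘ just-partialInjective emap-injective)

    restricted-links : ∀ l → Σ (Subset (nE (mg H))) λ S → Covers (AdhLink (restrict D) l) S × ∣ S ∣ ≤ w
    restricted-links l with links l
    ... | S , cover , size =
      pullback-emap S ,
      (λ j a → ∈-pullback⁺ refl (cover (emap j) (adhesion-emap (Disconnected (T D) (NotLink l)) Disconnected-sym j a))) ,
      ≤-trans (∣pullback-emap∣≤ S) size

    restricted-nodes : ∀ b → Σ (Subset (nV (mg H))) λ S₁ → Σ (Subset (nE (mg H))) λ S₂ →
                       Covers (InBag (restrict D) b) S₁ × Covers (AdhNode (restrict D) b) S₂ × ∣ S₁ ∣ + ∣ S₂ ∣ ≤ w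
    restricted-nodes b with nodes b
    ... | S₁ , S₂ , cover₁ , cover₂ , size =
      pullback (just ∘ vmap) S₁ , pullback-emap S₂ ,
      (λ x x∈b → ∈-pullback⁺ refl (cover₁ (vmap x) x∈b)) ,
      (λ j a → ∈-pullback⁺ refl (cover₂ (emap j) (adhesion-emap (SeparatedBy (T D) b) SeparatedBy-sym j a))) ,
      ≤-trans (+-mono-≤ (∣pullback∣≤ (PartialInjective-∘ just-partialInjective vmap-injective) S₁)
                        (∣pullback-emap∣≤ S₂))
              size

  scw-≤-width : ∀ {k} → IsScw H k → (D : TCD K) {w : ℕ} → WidthAtMost D w → k ≤ w
  scw-≤-width (_ , optimal) D W = optimal (restrict D) _ (restrict-width D W)

-- Gluing two trees by a new link

data SplitView (m n : ℕ) : Fin (m + n) → Set where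
  left  : (x : Fin m) → SplitView m n (x ↑ˡ n)
  right : (y : Fin n) → SplitView m n (m ↑ʳ y)

splitView : ∀ m n i → SplitView m n i
splitView m n i with splitAt m i | join-splitAt m n i
... | inj₁ x | eq = subst (SplitView m n) eq (left x)
... | inj₂ y | eq = subst (SplitView m n) eq (right y)

↑ˡ≢↑ʳ : {x : Fin m} {y : Fin n} → x ↑ˡ n ≢ m ↑ʳ y
↑ˡ≢↑ʳ {m} {n} {x} {y} eq with trans (sym (splitAt-↑ˡ m x n)) (trans (cong (splitAt m) eq) (splitAt-↑ʳ m n y))
... | ()

module Glue (T₁ T₂ : Multigraph) (a₁ : Fin (nV T₁)) (a₂ : Fin (nV T₂)) where

  private
    n₁ = nV T₁
    n₂ = nV T₂
    m₁ = nE T₁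
    m₂ = nE T₂

  ι₁ : Fin n₁ → Fin (n₁ + n₂)
  ι₁ x = x ↑ˡ n₂

  ι₂ : Fin n₂ → Fin (n₁ + n₂)
  ι₂ y = n₁ ↑ʳ y

  λ₁ : Fin m₁ → Fin (suc (m₁ + m₂))
  λ₁ l = suc (l ↑ˡ m₂)

  λ₂ : Fin m₂ → Fin (suc (m₁ + m₂))
  λ₂ l = suc (m₁ ↑ʳ l)

  bridgeLink : Fin (suc (m₁ + m₂))
  bridgeLink = zero

  private
    gluedEnds : Fin (suc (m₁ + m₂)) → Fin (n₁ + n₂) × Fin (n₁ + n₂)
    gluedEnds zero    = ι₁ a₁ , ι₂ a₂
    gluedEnds (suc i) = [ mapPair ι₁ ∘ ends T₁ , mapPair ι₂ ∘ ends T₂ ]′ (splitAt m₁ i)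

  C : Multigraph
  C = record { nV = n₁ + n₂ ; nE = suc (m₁ + m₂) ; ends = gluedEnds }

  data LinkView : Fin (nE C) → Set where
    new   : LinkView bridgeLink
    link₁ : ∀ l → LinkView (λ₁ l)
    link₂ : ∀ l → LinkView (λ₂ l)

  linkView : ∀ i → LinkView i
  linkView zero    = new
  linkView (suc i) with splitView m₁ m₂ i
  ... | left l  = link₁ l
  ... | right l = link₂ l

  ends-λ₁ : ∀ l → ends C (λ₁ l) ≡ mapPair ι₁ (ends T₁ l)
  ends-λ₁ l = cong [ mapPair ι₁ ∘ ends T₁ , mapPair ι₂ ∘ ends T₂ ]′ (splitAt-↑ˡ m₁ l m₂)

  ends-λ₂ : ∀ l → ends C (λ₂ l) ≡ mapPair ι₂ (ends T₂ l)
  ends-λ₂ l = cong [ mapPair ι₁ ∘ ends T₁ , mapPair ι₂ ∘ ends T₂ ]′ (splitAt-↑ʳ m₁ m₂ l)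

  hom₁ : Hom T₁ C
  hom₁ = record { vmap = ι₁ ; emap = λ₁ ; ends-emap = ≡⇒SameEnds ∘ ends-λ₁ }

  hom₂ : Hom T₂ C
  hom₂ = record { vmap = ι₂ ; emap = λ₂ ; ends-emap = ≡⇒SameEnds ∘ ends-λ₂ }

  ι₁-injective : Injective _≡_ _≡_ ι₁
  ι₁-injective = ↑ˡ-injective n₂ _ _

  ι₂-injective : Injective _≡_ _≡_ ι₂
  ι₂-injective = ↑ʳ-injective n₁ _ _

  ι₁≢ι₂ : ∀ {x y} → ι₁ x ≢ ι₂ y
  ι₁≢ι₂ = ↑ˡ≢↑ʳ

  λ₁-injective : Injective _≡_ _≡_ λ₁
  λ₁-injective = ↑ˡ-injective m₂ _ _ ∘ suc-injective

  λ₂-injective : Injective _≡_ _≡_ λ₂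
  λ₂-injective = ↑ʳ-injective m₁ _ _ ∘ suc-injective

  λ₁≢λ₂ : ∀ {x y} → λ₁ x ≢ λ₂ y
  λ₁≢λ₂ = ↑ˡ≢↑ʳ ∘ suc-injective

  bridgeStep : ∀ {ok} → ok bridgeLink → Walk C ok (ι₁ a₁) (ι₂ a₂)
  bridgeStep o = step bridgeLink o (inj₁ (refl , refl)) stay

  ends-λ₁-collapse : {A : Set} (f : Fin (n₁ + n₂) → A) {c : A} → (∀ x → f (ι₁ x) ≡ c) →
                     ∀ l → f (proj₁ (ends C (λ₁ l))) ≡ f (proj₂ (ends C (λ₁ l)))
  ends-λ₁-collapse f f≡c l rewrite ends-λ₁ l = trans (f≡c _) (sym (f≡c _))

  ends-λ₂-collapse : {A : Set} (f : Fin (n₁ + n₂) → A) {c : A} → (∀ x → f (ι₂ x) ≡ c) →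
                     ∀ l → f (proj₁ (ends C (λ₂ l))) ≡ f (proj₂ (ends C (λ₂ l)))
  ends-λ₂-collapse f f≡c l rewrite ends-λ₂ l = trans (f≡c _) (sym (f≡c _))

  module _ {A : Set} (f : Fin n₁ → A) (g : Fin n₂ → A) where

    [,]-ι₁ : ∀ x → [ f , g ]′ (splitAt n₁ (ι₁ x)) ≡ f x
    [,]-ι₁ x = cong [ f , g ]′ (splitAt-↑ˡ n₁ x n₂)

    [,]-ι₂ : ∀ y → [ f , g ]′ (splitAt n₁ (ι₂ y)) ≡ g y
    [,]-ι₂ y = cong [ f , g ]′ (splitAt-↑ʳ n₁ n₂ y)

  module _ (tree₁ : IsTree T₁) (tree₂ : IsTree T₂) where

    private
      walk₁ : ∀ x y → Walk C AllEdges (ι₁ x) (ι₁ y)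
      walk₁ x y = Hom.liftʷ hom₁ _ (IsTree.connected tree₁ x y)

      walk₂ : ∀ x y → Walk C AllEdges (ι₂ x) (ι₂ y)
      walk₂ x y = Hom.liftʷ hom₂ _ (IsTree.connected tree₂ x y)

      walk₁₂ : ∀ x y → Walk C AllEdges (ι₁ x) (ι₂ y)
      walk₁₂ x y = walk₁ x a₁ ++ʷ bridgeStep tt ++ʷ walk₂ a₂ y

      C-connected : Connected C
      C-connected u v with splitView n₁ n₂ u | splitView n₁ n₂ v
      ... | left x  | left y  = walk₁ x y
      ... | left x  | right y = walk₁₂ x y
      ... | right x | left y  = reverseʷ (walk₁₂ y x)
      ... | right x | right y = walk₂ x y

      retract₁ : Fin (n₁ + n₂) → Fin n₁
      retract₁ = [ id , const a₁ ]′ ∘ splitAt n₁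

      retract₂ : Fin (n₁ + n₂) → Fin n₂
      retract₂ = [ const a₂ , id ]′ ∘ splitAt n₁

      classify₁ : ∀ i → (∃ λ j → λ₁ j ≡ i) ⊎ retract₁ (proj₁ (ends C i)) ≡ retract₁ (proj₂ (ends C i))
      classify₁ i with linkView i
      ... | new     = inj₂ (trans ([,]-ι₁ id (const a₁) a₁) (sym ([,]-ι₂ id (const a₁) a₂)))
      ... | link₁ l = inj₁ (l , refl)
      ... | link₂ l = inj₂ (ends-λ₂-collapse retract₁ ([,]-ι₂ id (const a₁)) l)

      classify₂ : ∀ i → (∃ λ j → λ₂ j ≡ i) ⊎ retract₂ (proj₁ (ends C i)) ≡ retract₂ (proj₂ (ends C i))
      classify₂ i with linkView i
      ... | new     = inj₂ (trans ([,]-ι₁ (const a₂) id a₁) (sym ([,]-ι₂ (const a₂) id a₂)))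
      ... | link₁ l = inj₂ (ends-λ₁-collapse retract₂ ([,]-ι₁ (const a₂) id) l)
      ... | link₂ l = inj₁ (l , refl)

      module R₁ = Hom.Retraction hom₁ retract₁ ([,]-ι₁ id (const a₁)) classify₁
      module R₂ = Hom.Retraction hom₂ retract₂ ([,]-ι₂ (const a₂) id) classify₂

      onFirstTree : Fin (n₁ + n₂) → Bool
      onFirstTree = [ const true , const false ]′ ∘ splitAt n₁

      onFirstTree-preserved : ∀ i → NotLink bridgeLink i → onFirstTree (proj₁ (ends C i)) ≡ onFirstTree (proj₂ (ends C i))
      onFirstTree-preserved i i≢new with linkView i
      ... | new     = ⊥-elim (i≢new refl)
      ... | link₁ l = ends-λ₁-collapse onFirstTree ([,]-ι₁ (const true) (const false)) l
      ... | link₂ l = ends-λ₂-collapse onFirstTree ([,]-ι₂ (const true) (const false)) l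

      bridge-acyclic : Disconnected C (NotLink bridgeLink) (ι₁ a₁) (ι₂ a₂)
      bridge-acyclic w with trans (sym ([,]-ι₁ (const true) (const false) a₁))
                                  (trans (invariantʷ onFirstTree onFirstTree-preserved w)
                                         ([,]-ι₂ (const true) (const false) a₂))
      ... | ()

      C-acyclic : ∀ i → Disconnected C (NotLink i) (proj₁ (ends C i)) (proj₂ (ends C i))
      C-acyclic i with linkView i
      ... | new     = bridge-acyclic
      ... | link₁ l = R₁.acyclic-emap tree₁ l
      ... | link₂ l = R₂.acyclic-emap tree₂ l

    glue-isTree : IsTree C
    glue-isTree = record
      { nonempty  = <-≤-trans (IsTree.nonempty tree₁) (m≤m+n n₁ n₂)
      ; connected = C-connected
      ; acyclic   = C-acyclic
      }

-- Gluing decompositions of the two components along the bridge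

width-positive : {G : Graph} (D : TCD G) {w : ℕ} → WidthAtMost D w → Fin (nV (mg G)) → 1 ≤ w
width-positive D (_ , nodes) v with nodes (bag D v)
... | S₁ , _ , cover₁ , _ , size = ≤-trans (≤-trans (s≤s z≤n) (x∈p⇒∣p-x∣<∣p∣ (cover₁ v refl))) (≤-trans (m≤m+n _ _) size)

∀-by-to : {A : Set} (I : A ↔ Fin n) (P : Fin n → Set) → (∀ x → P (Inverse.to I x)) → ∀ y → P y
∀-by-to I P p y = subst P (Inverse.strictlyInverseˡ I y) (p (Inverse.from I y))

module BridgeGluing {G G₁ G₂ : Graph} (B : BridgeSplit G G₁ G₂) (D₁ : TCD G₁) (D₂ : TCD G₂)
                    {k₁ k₂ : ℕ} (W₁ : WidthAtMost D₁ k₁) (W₂ : WidthAtMost D₂ k₂) where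
  open BridgeSplit B
  open Glue (T D₁) (T D₂) (bag D₁ bridgeEnd₁) (bag D₂ bridgeEnd₂)

  private
    V = ⤖⇒↔ vtx
    E = ⤖⇒↔ edg
    module V = Inverse V
    module E = Inverse E

    E-from-injective : Injective _≡_ _≡_ E.from
    E-from-injective = Injection.injective (↔⇒↣ (↔-sym E))

    V-from-injective : Injective _≡_ _≡_ V.from
    V-from-injective = Injection.injective (↔⇒↣ (↔-sym V))

  nodeOf : Fin (nV (mg G₁)) ⊎ Fin (nV (mg G₂)) → Fin (nV C)
  nodeOf = [ ι₁ ∘ bag D₁ , ι₂ ∘ bag D₂ ]′

  glued : TCD G
  glued = record { T = C ; isTree = glue-isTree (isTree D₁) (isTree D₂) ; bag = nodeOf ∘ V.from }

  bag-glued : ∀ y → bag glued (V.to y) ≡ nodeOf y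
  bag-glued y = cong nodeOf (V.strictlyInverseʳ y)

  edgeBags : ⊤ ⊎ (Fin (nE (mg G₁)) ⊎ Fin (nE (mg G₂))) → Fin (nV C) × Fin (nV C)
  edgeBags (inj₁ _)        = ends C bridgeLink
  edgeBags (inj₂ (inj₁ j)) = mapPair ι₁ (bagEnds D₁ j)
  edgeBags (inj₂ (inj₂ j)) = mapPair ι₂ (bagEnds D₂ j)

  bagEnds-glued : ∀ x → SameEnds (bagEnds glued (E.to x)) (edgeBags x)
  bagEnds-glued (inj₁ _)        = SameEnds-≡ (SameEnds-map (bag glued) bridge) (bag-glued _) (bag-glued _)
  bagEnds-glued (inj₂ (inj₁ j)) = SameEnds-≡ (SameEnds-map (bag glued) (edges₁ j)) (bag-glued _) (bag-glued _)
  bagEnds-glued (inj₂ (inj₂ j)) = SameEnds-≡ (SameEnds-map (bag glued) (edges₂ j)) (bag-glued _) (bag-glued _)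

  covers-by-edgeBags : ∀ W → Symmetric W → (S : Subset (nE (mg G))) →
                       (∀ x → uncurry W (edgeBags x) → E.to x ∈ S) → Covers (uncurry W ∘ bagEnds glued) S
  covers-by-edgeBags W W-sym S cover = ∀-by-to E (λ e → uncurry W (bagEnds glued e) → e ∈ S)
    λ x → cover x ∘ SameEnds-transport W W-sym (SameEnds-sym (bagEnds-glued x))

  walk-ι₁ : ∀ {ok} → (∀ i → ok (λ₁ i)) → ∀ x y → Walk C ok (ι₁ x) (ι₁ y)
  walk-ι₁ ok-λ₁ x y = Hom.liftʷ hom₁ (λ i _ → ok-λ₁ i) (IsTree.connected (isTree D₁) x y)

  walk-ι₂ : ∀ {ok} → (∀ i → ok (λ₂ i)) → ∀ x y → Walk C ok (ι₂ x) (ι₂ y)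
  walk-ι₂ ok-λ₂ x y = Hom.liftʷ hom₂ (λ i _ → ok-λ₂ i) (IsTree.connected (isTree D₂) x y)

  vertex₁ : Fin (nV (mg G₁)) ⊎ Fin (nV (mg G₂)) → Maybe (Fin (nV (mg G₁)))
  vertex₁ = [ just , const nothing ]′

  vertex₂ : Fin (nV (mg G₁)) ⊎ Fin (nV (mg G₂)) → Maybe (Fin (nV (mg G₂)))
  vertex₂ = [ const nothing , just ]′

  edge₁ : ⊤ ⊎ (Fin (nE (mg G₁)) ⊎ Fin (nE (mg G₂))) → Maybe (Fin (nE (mg G₁)))
  edge₁ = [ const nothing , [ just , const nothing ]′ ]′

  edge₂ : ⊤ ⊎ (Fin (nE (mg G₁)) ⊎ Fin (nE (mg G₂))) → Maybe (Fin (nE (mg G₂)))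
  edge₂ = [ const nothing , [ const nothing , just ]′ ]′

  private
    pullback₁ : Subset (nE (mg G₁)) → Subset (nE (mg G))
    pullback₁ = pullback (edge₁ ∘ E.from)

    pullback₂ : Subset (nE (mg G₂)) → Subset (nE (mg G))
    pullback₂ = pullback (edge₂ ∘ E.from)

    ∣pullback₁∣≤ : ∀ S → ∣ pullback₁ S ∣ ≤ ∣ S ∣
    ∣pullback₁∣≤ = ∣pullback∣≤ (PartialInjective-∘ (PartialInjective-[nothing,] (PartialInjective-[,nothing] just-partialInjective)) E-from-injective)

    ∣pullback₂∣≤ : ∀ S → ∣ pullback₂ S ∣ ≤ ∣ S ∣
    ∣pullback₂∣≤ = ∣pullback∣≤ (PartialInjective-∘ (PartialInjective-[nothing,] (PartialInjective-[nothing,] just-partialInjective)) E-from-injective)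

    ∣pullbackᵛ₁∣≤ : ∀ S → ∣ pullback (vertex₁ ∘ V.from) S ∣ ≤ ∣ S ∣
    ∣pullbackᵛ₁∣≤ = ∣pullback∣≤ (PartialInjective-∘ (PartialInjective-[,nothing] just-partialInjective) V-from-injective)

    ∣pullbackᵛ₂∣≤ : ∀ S → ∣ pullback (vertex₂ ∘ V.from) S ∣ ≤ ∣ S ∣
    ∣pullbackᵛ₂∣≤ = ∣pullback∣≤ (PartialInjective-∘ (PartialInjective-[nothing,] just-partialInjective) V-from-injective)

    ∈-pullback₁ : ∀ {S j} → j ∈ S → E.to (inj₂ (inj₁ j)) ∈ pullback₁ S
    ∈-pullback₁ = ∈-pullback⁺ {h = edge₁ ∘ E.from} (cong edge₁ (E.strictlyInverseʳ _))

    ∈-pullback₂ : ∀ {S j} → j ∈ S → E.to (inj₂ (inj₂ j)) ∈ pullback₂ S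
    ∈-pullback₂ = ∈-pullback⁺ {h = edge₂ ∘ E.from} (cong edge₂ (E.strictlyInverseʳ _))

  LinkCover : Fin (nE C) → Set
  LinkCover l = Σ (Subset (nE (mg G))) λ S → Covers (AdhLink glued l) S × ∣ S ∣ ≤ k₁ ⊔ k₂

  bridgeLink-cover : LinkCover bridgeLink
  bridgeLink-cover =
    ⁅ bridgeEdge ⁆ ,
    covers-by-edgeBags (Disconnected C (NotLink bridgeLink)) Disconnected-sym ⁅ bridgeEdge ⁆ onlyBridge ,
    ≤-trans (≤-reflexive (∣⁅x⁆∣≡1 bridgeEdge)) (≤-trans (width-positive D₁ W₁ bridgeEnd₁) (m≤m⊔n k₁ k₂))
    where
    bridgeEdge = E.to (inj₁ tt)
    onlyBridge : ∀ x → uncurry (Disconnected C (NotLink bridgeLink)) (edgeBags x) → E.to x ∈ ⁅ bridgeEdge ⁆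
    onlyBridge (inj₁ tt)        _ = x∈⁅x⁆ bridgeEdge
    onlyBridge (inj₂ (inj₁ j)) a = ⊥-elim (a (walk-ι₁ (λ _ → 0≢1+n ∘ sym) _ _))
    onlyBridge (inj₂ (inj₂ j)) a = ⊥-elim (a (walk-ι₂ (λ _ → 0≢1+n ∘ sym) _ _))

  λ₁-cover : ∀ l → LinkCover (λ₁ l)
  λ₁-cover l with proj₁ W₁ l
  ... | S , cover , size =
    pullback₁ S ,
    covers-by-edgeBags (Disconnected C (NotLink (λ₁ l))) Disconnected-sym (pullback₁ S) onFirst ,
    ≤-trans (∣pullback₁∣≤ S) (≤-trans size (m≤m⊔n k₁ k₂))
    where
    onFirst : ∀ x → uncurry (Disconnected C (NotLink (λ₁ l))) (edgeBags x) → E.to x ∈ pullback₁ S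
    onFirst (inj₁ tt)        a = ⊥-elim (a (bridgeStep (0≢1+n)))
    onFirst (inj₂ (inj₁ j)) a = ∈-pullback₁ (cover j (a ∘ Hom.liftʷ hom₁ (λ i i≢l → i≢l ∘ λ₁-injective)))
    onFirst (inj₂ (inj₂ j)) a = ⊥-elim (a (walk-ι₂ (λ _ → λ₁≢λ₂ ∘ sym) _ _))

  λ₂-cover : ∀ l → LinkCover (λ₂ l)
  λ₂-cover l with proj₁ W₂ l
  ... | S , cover , size =
    pullback₂ S ,
    covers-by-edgeBags (Disconnected C (NotLink (λ₂ l))) Disconnected-sym (pullback₂ S) onSecond ,
    ≤-trans (∣pullback₂∣≤ S) (≤-trans size (m≤n⊔m k₁ k₂))
    where
    onSecond : ∀ x → uncurry (Disconnected C (NotLink (λ₂ l))) (edgeBags x) → E.to x ∈ pullback₂ S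
    onSecond (inj₁ tt)        a = ⊥-elim (a (bridgeStep (0≢1+n)))
    onSecond (inj₂ (inj₁ j)) a = ⊥-elim (a (walk-ι₁ (λ _ → λ₁≢λ₂) _ _))
    onSecond (inj₂ (inj₂ j)) a = ∈-pullback₂ (cover j (a ∘ Hom.liftʷ hom₂ (λ i i≢l → i≢l ∘ λ₂-injective)))

  NodeCover : Fin (nV C) → Set
  NodeCover b = Σ (Subset (nV (mg G))) λ S₁ → Σ (Subset (nE (mg G))) λ S₂ →
                Covers (InBag glued b) S₁ × Covers (AdhNode glued b) S₂ × ∣ S₁ ∣ + ∣ S₂ ∣ ≤ k₁ ⊔ k₂

  ι₁-cover : ∀ b → NodeCover (ι₁ b)
  ι₁-cover b with proj₂ W₁ b
  ... | S₁ , S₂ , cover₁ , cover₂ , size =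
    pullback (vertex₁ ∘ V.from) S₁ , pullback₁ S₂ ,
    ∀-by-to V (λ v → InBag glued (ι₁ b) v → v ∈ pullback (vertex₁ ∘ V.from) S₁)
      (λ y → inFirst y ∘ trans (sym (bag-glued y))) ,
    covers-by-edgeBags (SeparatedBy C (ι₁ b)) SeparatedBy-sym (pullback₁ S₂) onFirst ,
    ≤-trans (+-mono-≤ (∣pullbackᵛ₁∣≤ S₁) (∣pullback₁∣≤ S₂)) (≤-trans size (m≤m⊔n k₁ k₂))
    where
    inFirst : ∀ y → nodeOf y ≡ ι₁ b → V.to y ∈ pullback (vertex₁ ∘ V.from) S₁
    inFirst (inj₁ y) eq = ∈-pullback⁺ {h = vertex₁ ∘ V.from} (cong vertex₁ (V.strictlyInverseʳ _)) (cover₁ y (ι₁-injective eq))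
    inFirst (inj₂ y) eq = ⊥-elim (ι₁≢ι₂ (sym eq))
    onFirst : ∀ x → uncurry (SeparatedBy C (ι₁ b)) (edgeBags x) → E.to x ∈ pullback₁ S₂
    onFirst (inj₁ tt)        (p , q , n) = ⊥-elim (n (bridgeStep (p , q)))
    onFirst (inj₂ (inj₁ j)) (p , q , n) =
      ∈-pullback₁ (cover₂ j (p ∘ cong ι₁ , q ∘ cong ι₁ ,
        n ∘ Hom.liftʷ hom₁ (λ i (x≢b , y≢b) → Hom.NotIncident-emap hom₁ i (x≢b ∘ ι₁-injective) (y≢b ∘ ι₁-injective))))
    onFirst (inj₂ (inj₂ j)) (_ , _ , n) =
      ⊥-elim (n (walk-ι₂ (λ i → Hom.NotIncident-emap hom₂ i (ι₁≢ι₂ ∘ sym) (ι₁≢ι₂ ∘ sym)) _ _))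

  ι₂-cover : ∀ b → NodeCover (ι₂ b)
  ι₂-cover b with proj₂ W₂ b
  ... | S₁ , S₂ , cover₁ , cover₂ , size =
    pullback (vertex₂ ∘ V.from) S₁ , pullback₂ S₂ ,
    ∀-by-to V (λ v → InBag glued (ι₂ b) v → v ∈ pullback (vertex₂ ∘ V.from) S₁)
      (λ y → inSecond y ∘ trans (sym (bag-glued y))) ,
    covers-by-edgeBags (SeparatedBy C (ι₂ b)) SeparatedBy-sym (pullback₂ S₂) onSecond ,
    ≤-trans (+-mono-≤ (∣pullbackᵛ₂∣≤ S₁) (∣pullback₂∣≤ S₂)) (≤-trans size (m≤n⊔m k₁ k₂))
    where
    inSecond : ∀ y → nodeOf y ≡ ι₂ b → V.to y ∈ pullback (vertex₂ ∘ V.from) S₁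
    inSecond (inj₁ y) eq = ⊥-elim (ι₁≢ι₂ eq)
    inSecond (inj₂ y) eq = ∈-pullback⁺ {h = vertex₂ ∘ V.from} (cong vertex₂ (V.strictlyInverseʳ _)) (cover₁ y (ι₂-injective eq))
    onSecond : ∀ x → uncurry (SeparatedBy C (ι₂ b)) (edgeBags x) → E.to x ∈ pullback₂ S₂
    onSecond (inj₁ tt)        (p , q , n) = ⊥-elim (n (bridgeStep (p , q)))
    onSecond (inj₂ (inj₁ j)) (_ , _ , n) =
      ⊥-elim (n (walk-ι₁ (λ i → Hom.NotIncident-emap hom₁ i ι₁≢ι₂ ι₁≢ι₂) _ _))
    onSecond (inj₂ (inj₂ j)) (p , q , n) =
      ∈-pullback₂ (cover₂ j (p ∘ cong ι₂ , q ∘ cong ι₂ ,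
        n ∘ Hom.liftʷ hom₂ (λ i (x≢b , y≢b) → Hom.NotIncident-emap hom₂ i (x≢b ∘ ι₂-injective) (y≢b ∘ ι₂-injective))))

  glued-width : WidthAtMost glued (k₁ ⊔ k₂)
  glued-width = linkCover , nodeCover
    where
    linkCover : ∀ i → LinkCover i
    linkCover i with linkView i
    ... | new     = bridgeLink-cover
    ... | link₁ l = λ₁-cover l
    ... | link₂ l = λ₂-cover l
    nodeCover : ∀ b → NodeCover b
    nodeCover b with splitView (nV (T D₁)) (nV (T D₂)) b
    ... | left x  = ι₁-cover x
    ... | right y = ι₂-cover y

component₁ : {G G₁ G₂ : Graph} → BridgeSplit G G₁ G₂ → Embedding G₁ G
component₁ B = record
  { hom = record { vmap = V.to ∘ inj₁ ; emap = E.to ∘ inj₂ ∘ inj₁ ; ends-emap = edges₁ }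
  ; vmap-injective = inj₁-injective ∘ Bijection.injective vtx
  ; emap-injective = inj₁-injective ∘ inj₂-injective ∘ Bijection.injective edg
  }
  where open BridgeSplit B
        module V = Bijection vtx
        module E = Bijection edg

component₂ : {G G₁ G₂ : Graph} → BridgeSplit G G₁ G₂ → Embedding G₂ G
component₂ B = record
  { hom = record { vmap = V.to ∘ inj₂ ; emap = E.to ∘ inj₂ ∘ inj₂ ; ends-emap = edges₂ }
  ; vmap-injective = inj₂-injective ∘ Bijection.injective vtx
  ; emap-injective = inj₂-injective ∘ inj₂-injective ∘ Bijection.injective edg
  }
  where open BridgeSplit B
        module V = Bijection vtx
        module E = Bijection edg

mainTheorem8 : (G G₁ G₂ : Graph) → BridgeSplit G G₁ G₂ →
               (k₁ k₂ : ℕ) → IsScw G₁ k₁ → IsScw G₂ k₂ → IsScw G (k₁ ⊔ k₂)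
mainTheorem8 G G₁ G₂ B k₁ k₂ scw₁@((D₁ , W₁) , _) scw₂@((D₂ , W₂) , _) =
  (BridgeGluing.glued B D₁ D₂ W₁ W₂ , BridgeGluing.glued-width B D₁ D₂ W₁ W₂) ,
  λ D w W → ⊔-lub (scw-≤-width (component₁ B) scw₁ D W) (scw-≤-width (component₂ B) scw₂ D W)
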